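{- Let $(f,\bar f):C\to D$ be a morphism of $P$-algebras. Then $(f,\bar f)$ is a $P$-algebra equivalence if and only if $f:C\to D$ is an equivalence of types; in fact the canonical function $\pi_f:\mathsf{isalgequiv}(f,\bar f)\to\mathsf{isequiv}(f)$ (forgetting the algebra structure of the inverses and of the paths, then using the equivalence between $\mathsf{isequiv}(f)$ and the type of pairs of a left and a right inverse) is an equivalence of types.
   Context: Work in the intensional Martin-Löf type theory $\mathcal{H}$ with $\Sigma$-types, $\Pi$-types (with judgemental $\eta$), identity types, a universe $\mathsf{U}$ closed under $\Sigma,\Pi,\mathsf{Id}$, and function extensionality; no UIP. $\mathsf{iscontr}(X):=(\Sigma x:X)(\Pi y:X)\mathsf{Id}(x,y)$; $\mathsf{isequiv}(f):=(\Pi y)\mathsf{iscontr}((\Sigma x)\mathsf{Id}(fx,y))$, known to be equivalent to $(\Sigma g)\mathsf{Id}(gf,1)\times(\Sigma h)\mathsf{Id}(fh,1)$. Fix $A:\mathsf{U}$, $B:A\to\mathsf{U}$; $PC:=(\Sigma x:A)(B(x)\to C)$, $Pf(x,u)=(x,f\circ u)$ (defined by $\Sigma$-elimination). A $P$-algebra is $(C,\sup_C)$, $C:\mathsf{U}$, $\sup_C:PC\to C$. $\mathsf{Alg}(C,D):=(\Sigma f:C\to D)\mathsf{Id}(f\circ\sup_C,\sup_D\circ Pf)$. Composite of $(f,\bar f):C\to D$, $(g,\bar g):D\to E$: $g\circ f$ with path obtained by concatenating $g\circ\bar f$, $\bar g\circ Pf$ and $\sup_E$ whiskered with the canonical path $\mathsf{Id}(Pg\circ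 Pf,P(g\circ f))$; identity: $1_C$ with the canonical path coming from $\mathsf{Id}(P(1_C),1_{PC})$. $\mathsf{isalgequiv}(f):=(\Sigma g:\mathsf{Alg}(D,C))\mathsf{Id}_{\mathsf{Alg}(C,C)}(gf,1_C)\times(\Sigma h:\mathsf{Alg}(D,C))\mathsf{Id}_{\mathsf{Alg}(D,D)}(fh,1_D)$; $f$ is a $P$-algebra equivalence if this is inhabited. -}

{-# OPTIONS --without-K #-}
module Defs where

open import Data.Product using (Σ; _,_; proj₁; proj₂; _×_)
open import Function.Base using (_∘_; id)
open import Function.Bundles using (mk↔ₛ′)
open import Function.Properties.Inverse.HalfAdjointEquivalence using (_≃_; ↔⇒≃)
open import Relation.Binary.PropositionalEquality
  using (_≡_; refl; cong; cong-app; trans; sym)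

iscontr : Set → Set
iscontr X = Σ X (λ x → (y : X) → x ≡ y)

fib : {X Y : Set} → (X → Y) → Y → Set
fib {X} f y = Σ X (λ x → f x ≡ y)

isequiv : {X Y : Set} → (X → Y) → Set
isequiv {X} {Y} f = (y : Y) → iscontr (fib f y)

happly : {X : Set} {Y : X → Set} {f g : (x : X) → Y x} → f ≡ g → (x : X) → f x ≡ g x
happly p x = cong-app p x

FunExt : Set₁
FunExt = {X : Set} {Y : X → Set} (f g : (x : X) → Y x) → isequiv (happly {X} {Y} {f} {g})

biinv : {X Y : Set} → (X → Y) → Set
biinv {X} {Y} f = Σ (Y → X) (λ g → g ∘ f ≡ id) × Σ (Y → X) (λ h → f ∘ h ≡ id)

-- The (canonical) map from biinv(f) to isequiv(f):
-- biinv → quasi-inverse → half-adjoint equivalence → contractible fibres.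
private
  fibre-lemma : {X Y : Set} (to : X → Y) {a x : X} (q : a ≡ x) (e : to a ≡ to x)
              → cong to q ≡ e → _≡_ {A = fib to (to x)} (a , e) (x , refl)
  fibre-lemma to refl .refl refl = refl

biinv→isequiv : {X Y : Set} (f : X → Y) → biinv f → isequiv f
biinv→isequiv {X} {Y} f ((g , p) , (h , q)) = λ y → (center y , contr y)
  where
    ε : (y : Y) → f (h y) ≡ y
    ε = happly q
    η₀ : (x : X) → g (f x) ≡ x
    η₀ = happly p
    η : (x : X) → h (f x) ≡ x
    η x = trans (sym (η₀ (h (f x)))) (trans (cong g (ε (f x))) (η₀ x))
    E : X ≃ Y
    E = ↔⇒≃ (mk↔ₛ′ f h ε η)
    open _≃_ E
    center : (y : Y) → fib f y
    center y = (h y , right-inverse-of y)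
    contr : (y : Y) (z : fib f y) → center y ≡ z
    contr .(f x) (x , refl) =
      fibre-lemma f (left-inverse-of x) (right-inverse-of (f x)) (left-right x)

module Poly (A : Set) (B : A → Set) where

  P : Set → Set
  P C = Σ A (λ x → B x → C)

  Pmap : {C D : Set} → (C → D) → P C → P D
  Pmap f (x , u) = (x , f ∘ u)

  -- canonical paths (judgemental here, thanks to η for Σ-records)
  Pcomp : {C D E : Set} (g : D → E) (f : C → D) → Pmap g ∘ Pmap f ≡ Pmap (g ∘ f)
  Pcomp g f = refl

  Pid : {C : Set} → Pmap (id {A = C}) ≡ id
  Pid = refl

  PAlg : Set₁
  PAlg = Σ Set (λ C → P C → C)

  Alg : PAlg → PAlg → Set
  Alg (C , supC) (D , supD) = Σ (C → D) (λ f → f ∘ supC ≡ supD ∘ Pmap f)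

  algcomp : {𝒞 𝒟 ℰ : PAlg} → Alg 𝒞 𝒟 → Alg 𝒟 ℰ → Alg 𝒞 ℰ
  algcomp {C , supC} {D , supD} {E , supE} (f , f̄) (g , ḡ) =
    ( g ∘ f
    , trans (cong (g ∘_) f̄)
        (trans (cong (_∘ Pmap f) ḡ)
               (cong (supE ∘_) (Pcomp g f))) )

  algid : (𝒞 : PAlg) → Alg 𝒞 𝒞
  algid (C , supC) = (id , cong (supC ∘_) (sym (Pid {C})))

  isalgequiv : {𝒞 𝒟 : PAlg} → Alg 𝒞 𝒟 → Set
  isalgequiv {𝒞} {𝒟} f =
    Σ (Alg 𝒟 𝒞) (λ g → algcomp {𝒞} {𝒟} {𝒞} f g ≡ algid 𝒞)
      × Σ (Alg 𝒟 𝒞) (λ h → algcomp {𝒟} {𝒞} {𝒟} h f ≡ algid 𝒟)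

  isalgequiv→biinv : {𝒞 𝒟 : PAlg} (f : Alg 𝒞 𝒟) → isalgequiv f → biinv (proj₁ f)
  isalgequiv→biinv {𝒞} {𝒟} f ((g , p) , (h , q)) =
    ((proj₁ g , cong (proj₁ {B = λ k → k ∘ proj₂ 𝒞 ≡ proj₂ 𝒞 ∘ Pmap k}) p) , (proj₁ h , cong (proj₁ {B = λ k → k ∘ proj₂ 𝒟 ≡ proj₂ 𝒟 ∘ Pmap k}) q))

  πmap : {𝒞 𝒟 : PAlg} (f : Alg 𝒞 𝒟) → isalgequiv f → isequiv (proj₁ f)
  πmap {𝒞} {𝒟} f e = biinv→isequiv (proj₁ f) (isalgequiv→biinv {𝒞} {𝒟} f e)

{-# OPTIONS --without-K #-}
module Submission where

-- If f is an equivalence, then g ↦ g ∘ f and h ↦ f ∘ h are equivalences of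
-- algebra-morphism types, since on the function part they are pre- and
-- post-composition with f, and on the path part a composite of cong along an
-- equivalence with path concatenations.  The two halves of isalgequiv(f) are
-- fibres of these maps over the identity, so isalgequiv(f) is contractible as
-- soon as f is an equivalence.  As isequiv(f) is a proposition, π_f is then an
-- equivalence: its fibres are Σ-types of a contractible type and paths in a
-- proposition.

open import Defs
open import Data.Product using (Σ; _,_; proj₁; proj₂; _×_; map)
open import Function.Base using (_∘_; id)
open import Function.Bundles using (mk↔ₛ′)
open import Function.Properties.Inverse.HalfAdjointEquivalence using (_≃_; ↔⇒≃)
open import Relation.Binary.PropositionalEquality
open import Relation.Binary.PropositionalEquality.Properties

isProp : Set → Set
isProp X = (a b : X) → a ≡ b

iscontr⇒isProp : {X : Set} → iscontr X → isProp X
iscontr⇒isProp (c , h) a b = trans (sym (h a)) (h b)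

isProp⇒≡-iscontr : {X : Set} → isProp X → (a b : X) → iscontr (a ≡ b)
isProp⇒≡-iscontr P a b = trans (sym (P a a)) (P a b) , contraction
  where
    contraction : {b′ : _} (p : a ≡ b′) → trans (sym (P a a)) (P a b′) ≡ p
    contraction refl = trans-symˡ (P a a)

retract-iscontr : {X Y : Set} (r : Y → X) (s : X → Y) → ((x : X) → r (s x) ≡ x)
                → iscontr Y → iscontr X
retract-iscontr r s rs (c , h) = r c , λ x → trans (cong r (h (s x))) (rs x)

Σ-iscontr : {X : Set} {Y : X → Set} → iscontr X → ((x : X) → iscontr (Y x)) → iscontr (Σ X Y)
Σ-iscontr {X} {Y} (c , h) cY = (c , proj₁ (cY c)) , λ (x , y) → contraction (h x) y
  where
    contraction : {x : X} (p : c ≡ x) (y : Y x) → (c , proj₁ (cY c)) ≡ (x , y)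
    contraction refl y = cong (c ,_) (proj₂ (cY c) y)

isequiv-into-isProp : {X Y : Set} → isProp Y → (Y → iscontr X) → (f : X → Y) → isequiv f
isequiv-into-isProp PY cX f y =
  Σ-iscontr (cX y) (λ x → isProp⇒≡-iscontr PY (f x) y)

module _ {X X′ : Set} {Y : X → Set} {Y′ : X′ → Set}
         (e : X → X′) (φ : ∀ {x} → Y x → Y′ (e x)) where

  private
    -- The fibre of the total map over (x′ , y′) is a retract of a fibre of φ
    -- over a fibre of e.
    fib-fib : Σ X′ Y′ → Set
    fib-fib (x′ , y′) = Σ (fib e x′) (λ (x , p) → fib (φ {x}) (subst Y′ (sym p) y′))

    split : (z : Σ X′ Y′) → fib (map e φ) z → fib-fib z
    split .(e x , φ y) ((x , y) , refl) = (x , refl) , (y , refl)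

    join : (z : Σ X′ Y′) → fib-fib z → fib (map e φ) z
    join (.(e x) , .(φ y)) ((x , refl) , (y , refl)) = (x , y) , refl

    join-split : (z : Σ X′ Y′) (u : fib (map e φ) z) → join z (split z u) ≡ u
    join-split .(e x , φ y) ((x , y) , refl) = refl

  map-isequiv : isequiv e → (∀ x → isequiv (φ {x})) → isequiv (map e φ)
  map-isequiv ee eφ z@(x′ , y′) = retract-iscontr (join z) (split z) (join-split z)
    (Σ-iscontr (ee x′) (λ (x , p) → eφ x (subst Y′ (sym p) y′)))

qinv : {X Y : Set} → (X → Y) → Set
qinv {X} {Y} f = Σ (Y → X) λ g → ((x : X) → g (f x) ≡ x) × ((y : Y) → f (g y) ≡ y)

isequiv⇒qinv : {X Y : Set} (f : X → Y) → isequiv f → qinv f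
isequiv⇒qinv f e =
    (λ y → proj₁ (proj₁ (e y)))
  , (λ x → cong proj₁ (proj₂ (e (f x)) (x , refl)))
  , (λ y → proj₂ (proj₁ (e y)))

qinv-∘ : {X Y Z : Set} {f : X → Y} {g : Y → Z} → qinv g → qinv f → qinv (g ∘ f)
qinv-∘ {f = f} {g} (g′ , η′ , ε′) (f′ , η , ε) =
    f′ ∘ g′
  , (λ x → trans (cong f′ (η′ (f x))) (η x))
  , (λ z → trans (cong g (ε (g′ z))) (ε′ z))

trans-qinvˡ : {X : Set} {a b c : X} (p : a ≡ b) → qinv (λ (q : b ≡ c) → trans p q)
trans-qinvˡ refl = id , (λ _ → refl) , (λ _ → refl)

trans-qinvʳ : {X : Set} {a b c : X} (q : b ≡ c) → qinv (λ (p : a ≡ b) → trans p q)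
trans-qinvʳ refl = id , trans-reflʳ , trans-reflʳ

-- Promoting the quasi-inverse to a half-adjoint one makes the two
-- naturality squares for cong e close up.
cong-qinv : {X Y : Set} (e : X → Y) → qinv e → {a b : X} → qinv (cong e {a} {b})
cong-qinv {X} {Y} e (g , η₀ , ε₀) {a} {b} = cong⁻¹ , cong⁻¹-cong , cong-cong⁻¹
  where
    open _≃_ (↔⇒≃ (mk↔ₛ′ e g ε₀ η₀)) renaming (left-inverse-of to η; right-inverse-of to ε)
    open ≡-Reasoning

    cong⁻¹ : e a ≡ e b → a ≡ b
    cong⁻¹ q = trans (sym (η a)) (trans (cong g q) (η b))

    cong⁻¹-cong : {b′ : X} (p : a ≡ b′) → trans (sym (η a)) (trans (cong g (cong e p)) (η b′)) ≡ p
    cong⁻¹-cong refl = trans-symˡ (η a)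

    ε-natural : {y y′ : Y} (q : y ≡ y′) → trans (sym (ε y)) (trans (cong (e ∘ g) q) (ε y′)) ≡ q
    ε-natural {y} refl = trans-symˡ (ε y)

    cong-cong⁻¹ : (q : e a ≡ e b) → cong e (cong⁻¹ q) ≡ q
    cong-cong⁻¹ q = begin
        cong e (trans (sym (η a)) (trans (cong g q) (η b)))
          ≡⟨ sym (trans-cong (sym (η a))) ⟩
        trans (cong e (sym (η a))) (cong e (trans (cong g q) (η b)))
          ≡⟨ cong₂ trans (sym (sym-cong (η a))) (sym (trans-cong (cong g q))) ⟩
        trans (sym (cong e (η a))) (trans (cong e (cong g q)) (cong e (η b)))
          ≡⟨ cong₃ (λ u v w → trans (sym u) (trans v w)) (left-right a) (sym (cong-∘ q)) (left-right b) ⟩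
        trans (sym (ε (e a))) (trans (cong (e ∘ g) q) (ε (e b)))
          ≡⟨ ε-natural q ⟩
        q ∎
      where
        cong₃ : {U V W Z : Set} (k : U → V → W → Z) {u u′ : U} {v v′ : V} {w w′ : W}
              → u ≡ u′ → v ≡ v′ → w ≡ w′ → k u v w ≡ k u′ v′ w′
        cong₃ k refl refl refl = refl

module WithFunExt (FE : FunExt) where

  funext : {X : Set} {Y : X → Set} {u v : (x : X) → Y x} → ((x : X) → u x ≡ v x) → u ≡ v
  funext {u = u} {v} h = proj₁ (proj₁ (FE u v h))

  qinv⇒isequiv : {X Y : Set} (f : X → Y) → qinv f → isequiv f
  qinv⇒isequiv f (g , η , ε) = biinv→isequiv f ((g , funext η) , (g , funext ε))

  Π-isProp : {X : Set} {Y : X → Set} → ((x : X) → isProp (Y x)) → isProp ((x : X) → Y x)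
  Π-isProp P u v = funext λ x → P x (u x) (v x)

  iscontr-isProp : {X : Set} → isProp (iscontr X)
  iscontr-isProp {X} (c , h) (c′ , h′) = lemma (h c′) h h′
    where
      lemma : {c c′ : X} (p : c ≡ c′) (h : (y : X) → c ≡ y) (h′ : (y : X) → c′ ≡ y)
            → (c , h) ≡ (c′ , h′)
      lemma {c} refl h h′ = cong (c ,_) (funext λ y →
        iscontr⇒isProp (isProp⇒≡-iscontr (iscontr⇒isProp (c , h)) c y) (h y) (h′ y))

  isequiv-isProp : {X Y : Set} (f : X → Y) → isProp (isequiv f)
  isequiv-isProp f = Π-isProp (λ y → iscontr-isProp)

  precompose-qinv : {X Y Z : Set} {k : X → Y} → qinv k → qinv (λ (u : Y → Z) → u ∘ k)
  precompose-qinv (k′ , η , ε) =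
    (_∘ k′) , (λ u → funext λ y → cong u (ε y)) , (λ v → funext λ x → cong v (η x))

  postcompose-qinv : {X Y Z : Set} {k : X → Y} → qinv k → qinv (λ (u : Z → X) → k ∘ u)
  postcompose-qinv (k′ , η , ε) =
    (k′ ∘_) , (λ u → funext λ z → η (u z)) , (λ v → funext λ z → ε (v z))

  module _ (A : Set) (B : A → Set) where
    open Poly A B

    Pmap-qinv : {C D : Set} {k : C → D} → qinv k → qinv (Pmap k)
    Pmap-qinv (k′ , η , ε) =
        Pmap k′
      , (λ (a , u) → cong (a ,_) (funext (η ∘ u)))
      , (λ (a , u) → cong (a ,_) (funext (ε ∘ u)))

    algcomp-precompose-isequiv : (𝒞 𝒟 ℰ : PAlg) (f : Alg 𝒞 𝒟) → isequiv (proj₁ f)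
                               → isequiv (λ (g : Alg 𝒟 ℰ) → algcomp {𝒞} {𝒟} {ℰ} f g)
    algcomp-precompose-isequiv (C , supC) (D , supD) (E , supE) (f , f̄) ef =
      map-isequiv (_∘ f)
        (λ {g} ḡ → trans (cong (g ∘_) f̄) (trans (cong (_∘ Pmap f) ḡ) refl))
        (qinv⇒isequiv _ (precompose-qinv qf))
        (λ g → qinv⇒isequiv _
          (qinv-∘ (trans-qinvˡ (cong (g ∘_) f̄))
            (qinv-∘ (trans-qinvʳ refl) (cong-qinv (_∘ Pmap f) (precompose-qinv (Pmap-qinv qf))))))
      where qf = isequiv⇒qinv f ef

    algcomp-postcompose-isequiv : (𝒞 𝒟 ℰ : PAlg) (f : Alg 𝒞 𝒟) → isequiv (proj₁ f)
                                → isequiv (λ (h : Alg ℰ 𝒞) → algcomp {ℰ} {𝒞} {𝒟} h f)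
    algcomp-postcompose-isequiv (C , supC) (D , supD) (E , supE) (f , f̄) ef =
      map-isequiv (f ∘_)
        (λ {h} h̄ → trans (cong (f ∘_) h̄) (trans (cong (_∘ Pmap h) f̄) refl))
        (qinv⇒isequiv _ (postcompose-qinv qf))
        (λ h → qinv⇒isequiv _ (qinv-∘ (trans-qinvʳ _) (cong-qinv (f ∘_) (postcompose-qinv qf))))
      where qf = isequiv⇒qinv f ef

    isalgequiv-iscontr : (𝒞 𝒟 : PAlg) (f : Alg 𝒞 𝒟) → isequiv (proj₁ f) → iscontr (isalgequiv {𝒞} {𝒟} f)
    isalgequiv-iscontr 𝒞 𝒟 f ef =
      Σ-iscontr (algcomp-precompose-isequiv 𝒞 𝒟 𝒞 f ef (algid 𝒞))
                (λ _ → algcomp-postcompose-isequiv 𝒞 𝒟 𝒟 f ef (algid 𝒟))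

proposition4p11 : FunExt → (A : Set) (B : A → Set) (𝒞 𝒟 : Poly.PAlg A B) (f : Poly.Alg A B 𝒞 𝒟)
    → ((Poly.isalgequiv A B {𝒞} {𝒟} f → isequiv (proj₁ f)) × (isequiv (proj₁ f) → Poly.isalgequiv A B {𝒞} {𝒟} f))
    × isequiv (Poly.πmap A B {𝒞} {𝒟} f)
proposition4p11 FE A B 𝒞 𝒟 f =
    (πmap {𝒞} {𝒟} f , proj₁ ∘ isalgequiv-iscontr A B 𝒞 𝒟 f)
  , isequiv-into-isProp (isequiv-isProp (proj₁ f)) (isalgequiv-iscontr A B 𝒞 𝒟 f) (πmap {𝒞} {𝒟} f)
  where
    open WithFunExt FE
    open Poly A B
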